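{- Let $q$ be a prime power, let $A\in\mathbb{F}_q^{m\times k}$ be a nonzero matrix, and let $S\subseteq\mathbb{F}_q^n$ have size at least $q^{1+(1-\frac1k)n}$. Then there exist $(x_1,\dots,x_k),(y_1,\dots,y_k)\in S^k$ such that for all $b=(b_1,\dots,b_k)\in\mathbb{F}_q^k$: $b_1x_1+\dots+b_kx_k=b_1y_1+\dots+b_ky_k$ if and only if $b$ is a linear combination of the rows of $A$. -}

module Defs where

open import Level using (0ℓ)
open import Data.Nat using (ℕ; suc; _^_)
open import Data.Nat.Primality using (Prime)
open import Data.Fin using (Fin)
open import Data.Product using (∃; ∃₂; _×_)
open import Relation.Binary.PropositionalEquality using (_≡_; _≢_)
open import Relation.Nullary using (¬_)
open import Algebra.Structures using (IsCommutativeRing)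

IsPrimePower : ℕ → Set
IsPrimePower q = ∃₂ λ p e → Prime p × q ≡ p ^ suc e

-- A field structure on the finite set Fin q (with propositional equality).
-- Every finite field with q elements is isomorphic to one of these.
record FiniteField (q : ℕ) : Set where
  field
    _+_ _*_ : Fin q → Fin q → Fin q
    -_      : Fin q → Fin q
    0# 1#   : Fin q
    isCommutativeRing : IsCommutativeRing _≡_ _+_ _*_ -_ 0# 1#
    0≢1     : 0# ≢ 1#
    inverse : ∀ x → x ≢ 0# → ∃ λ y → x * y ≡ 1#

  infixl 6 _+_
  infixl 7 _*_

  sumF : ∀ {k} → (Fin k → Fin q) → Fin q
  sumF {ℕ.zero}  f = 0#
  sumF {suc k} f = f Fin.zero + sumF (λ i → f (Fin.suc i))

  Matrix : ℕ → ℕ → Set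
  Matrix m k = Fin m → Fin k → Fin q

  NonZeroMatrix : ∀ {m k} → Matrix m k → Set
  NonZeroMatrix A = ∃₂ λ i j → A i j ≢ 0#

  InRowSpace : ∀ {m k} → Matrix m k → (Fin k → Fin q) → Set
  InRowSpace {m} A b = ∃ λ (c : Fin m → Fin q) → ∀ j → b j ≡ sumF (λ i → c i * A i j)

  lincomb : ∀ {k n} → (Fin k → Fin q) → (Fin k → Fin n → Fin q) → Fin n → Fin q
  lincomb b x t = sumF (λ j → b j * x j t)

module Submission where

-- Bring the row space R of A into reduced echelon form, with r pivot and s = k − r free
-- coordinates. The pivot rows define a linear map φ : (F_q^n)^k → (F_q^n)^r. If x and y lie in
-- one fibre of φ, then Σ b_j (x_j − y_j) = 0 for every b ∈ R, and there are no other such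
-- relations as soon as each free difference x_j − y_j lies outside the span of the later
-- differences. Some fibre of φ meets S^k in at least |S|^k / q^(nr) tuples, while for fixed x fewer
-- than q^(k + ns) / q^n tuples y in a fibre violate the independence condition, since at a free
-- coordinate it fails for at most q^k values of y_j. The hypothesis |S|^k ≥ q^(k + (k−1)n) makes
-- the first count exceed the second.

open import Defs
open import Data.Nat using (ℕ; zero; suc)
open import Data.List using (List)
open import Data.List.Relation.Unary.Unique.Propositional using (Unique)

module Sums where

  open import Level using (0ℓ)
  open import Data.Nat using (_+_; _*_; _≤_; _<_; z≤n; s≤s; s<s⁻¹)
  open import Data.Nat.Properties
  open import Algebra.Properties.CommutativeSemigroup +-commutativeSemigroup
    using () renaming (interchange to +-interchange)
  open import Data.List using ([]; _∷_; length; map; _++_; cartesianProductWith)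
  open import Data.List.Membership.Propositional using (_∈_)
  open import Data.List.Relation.Unary.Any using (here; there)
  open import Data.List.Relation.Unary.All as All using (All; []; _∷_)
  open import Data.List.Relation.Unary.Unique.Propositional using ([]; _∷_)
  open import Data.Product using (∃; _×_; _,_; proj₁; proj₂)
  open import Data.Unit using (tt)
  open import Relation.Nullary using (Dec; yes; no; ¬?; contradiction)
  open import Relation.Nullary.Decidable using (_×-dec_)
  open import Relation.Unary using (Pred; Decidable; ∁)
  open import Relation.Unary.Properties using (∁?; _∩?_)
  open import Relation.Binary.Definitions using (DecidableEquality)
  open import Relation.Binary.PropositionalEquality

  𝟙 : {P : Set} → Dec P → ℕ
  𝟙 (yes _) = 1
  𝟙 (no _)  = 0

  𝟙-mono : {P R : Set} (P? : Dec P) (R? : Dec R) → (P → R) → 𝟙 P? ≤ 𝟙 R?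
  𝟙-mono (yes p) (yes _) P⇒R = ≤-refl
  𝟙-mono (yes p) (no ¬r) P⇒R = contradiction (P⇒R p) ¬r
  𝟙-mono (no _)  R?      P⇒R = z≤n

  𝟙-union-bound : ∀ {A I W : Set} (A? : Dec A) (I? : Dec I) (W? : Dec W) →
                  𝟙 (A? ×-dec ¬? (I? ×-dec ¬? W?)) ≤ 𝟙 (A? ×-dec ¬? I?) + 𝟙 A? * 𝟙 W?
  𝟙-union-bound (no _)  I?      W?      = z≤n
  𝟙-union-bound (yes _) (no _)  W?      = s≤s z≤n
  𝟙-union-bound (yes _) (yes _) (no _)  = z≤n
  𝟙-union-bound (yes _) (yes _) (yes _) = s≤s z≤n

  ∑ : {A : Set} → List A → (A → ℕ) → ℕ
  ∑ []      f = 0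
  ∑ (a ∷ L) f = f a + ∑ L f

  infix 5 ∑
  syntax ∑ L (λ a → f) = ∑[ a ∈ L ] f

  module _ {A : Set} where

    ∑-cong : ∀ (L : List A) {f g : A → ℕ} → f ≗ g → ∑ L f ≡ ∑ L g
    ∑-cong []      f≗g = refl
    ∑-cong (a ∷ L) f≗g = cong₂ _+_ (f≗g a) (∑-cong L f≗g)

    ∑-mono-≤ : ∀ (L : List A) {f g : A → ℕ} → (∀ a → f a ≤ g a) → ∑ L f ≤ ∑ L g
    ∑-mono-≤ []      f≤g = z≤n
    ∑-mono-≤ (a ∷ L) f≤g = +-mono-≤ (f≤g a) (∑-mono-≤ L f≤g)

    ∑-distrib-+ : ∀ (L : List A) (f g : A → ℕ) → ∑[ a ∈ L ] (f a + g a) ≡ ∑ L f + ∑ L g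
    ∑-distrib-+ []      f g = refl
    ∑-distrib-+ (a ∷ L) f g =
      trans (cong (f a + g a +_) (∑-distrib-+ L f g)) (+-interchange (f a) (g a) _ _)

    ∑-const : ∀ (L : List A) c → ∑[ _ ∈ L ] c ≡ length L * c
    ∑-const []      c = refl
    ∑-const (a ∷ L) c = cong (c +_) (∑-const L c)

    ∑-distribˡ-* : ∀ (L : List A) c (f : A → ℕ) → ∑[ a ∈ L ] (c * f a) ≡ c * ∑ L f
    ∑-distribˡ-* []      c f = sym (*-zeroʳ c)
    ∑-distribˡ-* (a ∷ L) c f =
      trans (cong (c * f a +_) (∑-distribˡ-* L c f)) (sym (*-distribˡ-+ c (f a) _))

    ∈⇒≤∑ : ∀ {L : List A} (f : A → ℕ) {a} → a ∈ L → f a ≤ ∑ L f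
    ∈⇒≤∑ f (here refl) = m≤m+n _ _
    ∈⇒≤∑ f (there a∈L) = ≤-trans (∈⇒≤∑ f a∈L) (m≤n+m _ _)

    -- The third argument is the answer for the empty list.
    ∃-∑≤length*term : ∀ (L : List A) (g : A → ℕ) → A → ∃ λ a → ∑ L g ≤ length L * g a
    ∃-∑≤length*term []      g a₀ = a₀ , z≤n
    ∃-∑≤length*term (b ∷ L) g a₀ with ∃-∑≤length*term L g a₀
    ... | a , ∑≤ with g b ≤? g a
    ...   | yes gb≤ga = a , +-mono-≤ gb≤ga ∑≤
    ...   | no  gb≰ga = b , +-monoʳ-≤ (g b) (≤-trans ∑≤ (*-monoʳ-≤ (length L) (<⇒≤ (≰⇒> gb≰ga))))

  module _ {A B : Set} where

    ∑-comm : ∀ (L : List A) (M : List B) (f : A → B → ℕ) →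
             ∑[ a ∈ L ] ∑[ b ∈ M ] f a b ≡ ∑[ b ∈ M ] ∑[ a ∈ L ] f a b
    ∑-comm []      M f = sym (trans (∑-const M 0) (*-zeroʳ (length M)))
    ∑-comm (a ∷ L) M f = trans (cong (∑ M (f a) +_) (∑-comm L M f)) (sym (∑-distrib-+ M (f a) _))

    ∑-map : ∀ (L : List A) (h : A → B) (f : B → ℕ) → ∑ (map h L) f ≡ ∑[ a ∈ L ] f (h a)
    ∑-map []      h f = refl
    ∑-map (a ∷ L) h f = cong (f (h a) +_) (∑-map L h f)

  ∑-++ : ∀ {A : Set} (L M : List A) (f : A → ℕ) → ∑ (L ++ M) f ≡ ∑ L f + ∑ M f
  ∑-++ []      M f = refl
  ∑-++ (a ∷ L) M f = trans (cong (f a +_) (∑-++ L M f)) (sym (+-assoc (f a) _ _))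

  ∑-cartesianProductWith : ∀ {A B C : Set} (h : A → B → C) (L : List A) (M : List B) (f : C → ℕ) →
                           ∑ (cartesianProductWith h L M) f ≡ ∑[ a ∈ L ] ∑[ b ∈ M ] f (h a b)
  ∑-cartesianProductWith h []      M f = refl
  ∑-cartesianProductWith h (a ∷ L) M f =
    trans (∑-++ (map (h a) M) _ f) (cong₂ _+_ (∑-map M (h a) f) (∑-cartesianProductWith h L M f))

  count : {A : Set} {P : Pred A 0ℓ} → Decidable P → List A → ℕ
  count P? L = ∑[ a ∈ L ] 𝟙 (P? a)

  module _ {A : Set} {P : Pred A 0ℓ} (P? : Decidable P) where

    count>0⇒∃ : ∀ (L : List A) → 0 < count P? L → ∃ λ a → a ∈ L × P a
    count>0⇒∃ (a ∷ L) 0<count with P? a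
    ... | yes pa = a , here refl , pa
    ... | no  _  = let b , b∈L , pb = count>0⇒∃ L 0<count in b , there b∈L , pb

    𝟙≤count : ∀ {L : List A} {R : Set} (R? : Dec R) → (R → ∃ λ a → a ∈ L × P a) →
              𝟙 R? ≤ count P? L
    𝟙≤count (no _)  R⇒∃ = z≤n
    𝟙≤count (yes r) R⇒∃ = let a , a∈L , pa = R⇒∃ r in
      ≤-trans (𝟙-mono (yes r) (P? a) (λ _ → pa)) (∈⇒≤∑ (λ b → 𝟙 (P? b)) a∈L)

    count≡0 : ∀ {L : List A} → All (∁ P) L → count P? L ≡ 0
    count≡0 []                   = refl
    count≡0 {a ∷ L} (¬pa ∷ ¬P[L]) with P? a
    ... | yes pa = contradiction pa ¬pa
    ... | no  _  = count≡0 ¬P[L]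

    count≤𝟙 : ∀ {L : List A} → Unique L → {R : Set} (R? : Dec R) {g : A} →
              (∀ {a} → P a → a ≡ g × R) → count P? L ≤ 𝟙 R?
    count≤𝟙 []                  R? P⇒≡g = z≤n
    count≤𝟙 {a ∷ L} (a∉L ∷ uL) R? P⇒≡g with P? a
    ... | no  _  = count≤𝟙 uL R? P⇒≡g
    ... | yes pa = ≤-trans (≤-reflexive (cong suc (count≡0 (All.map ≢a⇒¬P a∉L))))
                           (𝟙-mono (yes pa) R? (λ _ → proj₂ (P⇒≡g pa)))
      where
      ≢a⇒¬P : ∀ {b} → a ≢ b → ∁ P b
      ≢a⇒¬P a≢b pb = a≢b (trans (proj₁ (P⇒≡g pa)) (sym (proj₁ (P⇒≡g pb))))

    count-∩∁<count⇒∃ : ∀ {Q : Pred A 0ℓ} (Q? : Decidable Q) (L : List A) →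
                       count (P? ∩? ∁? Q?) L < count P? L → ∃ λ a → a ∈ L × P a × Q a
    count-∩∁<count⇒∃ Q? (a ∷ L) count< with P? a | Q? a
    ... | yes pa | yes qa = a , here refl , pa , qa
    ... | yes _  | no  _  = let b , b∈L , pqb = count-∩∁<count⇒∃ Q? L (s<s⁻¹ count<) in b , there b∈L , pqb
    ... | no  _  | _      = let b , b∈L , pqb = count-∩∁<count⇒∃ Q? L count< in b , there b∈L , pqb

  count≤length : ∀ {A B : Set} {P : Pred A 0ℓ} → DecidableEquality A → (P? : Decidable P) {L : List A} →
                 Unique L → (M : List B) (g : B → A) → (∀ {a} → P a → ∃ λ b → b ∈ M × a ≡ g b) →
                 count P? L ≤ length M
  count≤length _≟_ P? {L} uL M g P⇒image = begin
    count P? L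
      ≤⟨ ∑-mono-≤ L (λ a → 𝟙≤count (λ b → a ≟ g b) (P? a) P⇒image) ⟩
    ∑[ a ∈ L ] count (λ b → a ≟ g b) M
      ≡⟨ ∑-comm L M (λ a b → 𝟙 (a ≟ g b)) ⟩
    ∑[ b ∈ M ] count (_≟ g b) L
      ≤⟨ ∑-mono-≤ M (λ b → count≤𝟙 (_≟ g b) uL (yes tt) (_, tt)) ⟩
    ∑[ b ∈ M ] 1
      ≡⟨ trans (∑-const M 1) (*-identityʳ _) ⟩
    length M ∎
    where open ≤-Reasoning

module Enumeration where

  open import Data.Nat using (_+_; _*_; _^_)
  open import Data.Vec using (Vec; []; _∷_)
  open import Data.List as List using (length; map; cartesianProductWith)
  open import Data.List.Properties using (length-++; length-map)
  open import Data.List.Membership.Propositional using (_∈_)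
  open import Data.List.Membership.Propositional.Properties using (∈-cartesianProductWith⁺)
  open import Data.List.Relation.Unary.Any using (here)
  open import Relation.Binary.PropositionalEquality using (_≡_; refl; trans; cong; cong₂)

  length-cartesianProductWith : ∀ {A B C : Set} (f : A → B → C) (L : List A) (M : List B) →
                                length (cartesianProductWith f L M) ≡ length L * length M
  length-cartesianProductWith f List.[]       M = refl
  length-cartesianProductWith f (a List.∷ L) M =
    trans (length-++ (map (f a) M)) (cong₂ _+_ (length-map (f a) M) (length-cartesianProductWith f L M))

  vecsOver : ∀ {A : Set} → List A → (m : ℕ) → List (Vec A m)
  vecsOver L zero    = List.[ [] ]
  vecsOver L (suc m) = cartesianProductWith _∷_ L (vecsOver L m)

  ∈-vecsOver : ∀ {A : Set} {L : List A} → (∀ a → a ∈ L) → ∀ {m} (v : Vec A m) → v ∈ vecsOver L m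
  ∈-vecsOver ∈L []      = here refl
  ∈-vecsOver ∈L (a ∷ v) = ∈-cartesianProductWith⁺ _∷_ (∈L a) (∈-vecsOver ∈L v)

  length-vecsOver : ∀ {A : Set} (L : List A) m → length (vecsOver L m) ≡ length L ^ m
  length-vecsOver L zero    = refl
  length-vecsOver L (suc m) =
    trans (length-cartesianProductWith _∷_ L (vecsOver L m)) (cong (length L *_) (length-vecsOver L m))

module Powers where

  open import Data.Nat using (_+_; _*_; _^_; _≤_; _∸_; NonZero)
  open import Data.Nat.Properties using (≤-trans; ≤-reflexive; *-identityʳ; m^n>0; ^-*-assoc; ^-distribˡ-+-*)
  open import Data.Nat.Tactic.RingSolver using (solve-∀)
  open import Relation.Binary.PropositionalEquality using (_≡_; sym; cong; module ≡-Reasoning)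

  power-bound : ∀ q n k → .{{NonZero q}} → q ^ k * (q ^ n) ^ k ≤ q ^ n * q ^ (k + (k ∸ 1) * n)
  power-bound q n zero    = ≤-trans (m^n>0 q n) (≤-reflexive (sym (*-identityʳ (q ^ n))))
  power-bound q n (suc m) = ≤-reflexive (begin
    q ^ suc m * (q ^ n) ^ suc m  ≡⟨ cong (q ^ suc m *_) (^-*-assoc q n (suc m)) ⟩
    q ^ suc m * q ^ (n * suc m)  ≡⟨ sym (^-distribˡ-+-* q (suc m) (n * suc m)) ⟩
    q ^ (suc m + n * suc m)      ≡⟨ cong (q ^_) (exponents m n) ⟩
    q ^ (n + (suc m + m * n))    ≡⟨ ^-distribˡ-+-* q n _ ⟩
    q ^ n * q ^ (suc m + m * n)  ∎)
    where
    open ≡-Reasoning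
    exponents : ∀ m n → suc m + n * suc m ≡ n + (suc m + m * n)
    exponents = solve-∀

module FieldAlgebra {q : ℕ} (F : FiniteField q) where

  open import Level using (0ℓ)
  open import Data.Fin using (Fin; zero; suc)
  open import Data.Vec.Functional using (Vector; tail)
  open import Algebra.Bundles using (CommutativeRing)
  open import Function using (_∘_)
  open import Relation.Binary.PropositionalEquality

  open FiniteField F public

  commutativeRing : CommutativeRing 0ℓ 0ℓ
  commutativeRing = record { isCommutativeRing = isCommutativeRing }

  open CommutativeRing commutativeRing public
    using (_-_; +-comm; +-identityˡ; +-identityʳ; *-assoc; *-comm; *-identityˡ; *-identityʳ;
           distribˡ; distribʳ; zeroˡ; zeroʳ)
  open import Algebra.Properties.Ring (CommutativeRing.ring commutativeRing) public
    using (x[y-z]≈xy-xz; [y-z]x≈yx-zx; -‿distribˡ-*; -‿distribʳ-*; -‿+-comm;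
           //-rightDividesˡ; //-rightDividesʳ; +-inverseˡ-unique; x∙y⁻¹≈ε⇒x≈y; x≈y⇒x∙y⁻¹≈ε)
  open import Algebra.Properties.CommutativeSemigroup (CommutativeRing.+-commutativeSemigroup commutativeRing)
    public using () renaming (interchange to +-interchange)

  Coeffs : ℕ → Set
  Coeffs = Vector (Fin q)

  +≡⇒≡- : ∀ {a b c} → a + b ≡ c → a ≡ c - b
  +≡⇒≡- {a} {b} a+b≡c = trans (sym (//-rightDividesʳ b a)) (cong (_- b) a+b≡c)

  -≡⇒≡- : ∀ {a b c} → a - b ≡ c → b ≡ a - c
  -≡⇒≡- {a} {b} a-b≡c =
    +≡⇒≡- (trans (cong (b +_) (sym a-b≡c)) (trans (+-comm b (a - b)) (//-rightDividesˡ b a)))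

  sub-+-sub : ∀ a b c d → (a - c) + (b - d) ≡ (a + b) - (c + d)
  sub-+-sub a b c d = trans (+-interchange a (- c) b (- d)) (cong (a + b +_) (-‿+-comm c d))

  sumF-cong : ∀ {k} {f g : Coeffs k} → f ≗ g → sumF f ≡ sumF g
  sumF-cong {zero}  f≗g = refl
  sumF-cong {suc k} f≗g = cong₂ _+_ (f≗g zero) (sumF-cong (f≗g ∘ suc))

  sumF-distrib-+ : ∀ {k} (f g : Coeffs k) → sumF (λ j → f j + g j) ≡ sumF f + sumF g
  sumF-distrib-+ {zero}  f g = sym (+-identityʳ 0#)
  sumF-distrib-+ {suc k} f g =
    trans (cong (f zero + g zero +_) (sumF-distrib-+ (tail f) (tail g))) (+-interchange _ _ _ _)

  sumF-distrib-- : ∀ {k} (f g : Coeffs k) → sumF (λ j → f j - g j) ≡ sumF f - sumF g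
  sumF-distrib-- {zero}  f g = sym (x≈y⇒x∙y⁻¹≈ε refl)
  sumF-distrib-- {suc k} f g =
    trans (cong (f zero - g zero +_) (sumF-distrib-- (tail f) (tail g))) (sub-+-sub _ _ _ _)

  sumF-distribˡ-* : ∀ {k} c (f : Coeffs k) → sumF (λ j → c * f j) ≡ c * sumF f
  sumF-distribˡ-* {zero}  c f = sym (zeroʳ c)
  sumF-distribˡ-* {suc k} c f =
    trans (cong (c * f zero +_) (sumF-distribˡ-* c (tail f))) (sym (distribˡ c _ _))

  module _ {k n : ℕ} where

    lincomb-congˡ : ∀ {u w : Coeffs k} (X : Vector (Coeffs n) k) → u ≗ w → lincomb u X ≗ lincomb w X
    lincomb-congˡ X u≗w t = sumF-cong (λ j → cong (_* X j t) (u≗w j))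

    lincomb-*ˡ : ∀ c (u : Coeffs k) (X : Vector (Coeffs n) k) t →
                 lincomb (λ j → c * u j) X t ≡ c * lincomb u X t
    lincomb-*ˡ c u X t =
      trans (sumF-cong (λ j → *-assoc c (u j) (X j t))) (sumF-distribˡ-* c (λ j → u j * X j t))

    lincomb--ˡ : ∀ (u w : Coeffs k) (X : Vector (Coeffs n) k) t →
                 lincomb (λ j → u j - w j) X t ≡ lincomb u X t - lincomb w X t
    lincomb--ˡ u w X t = trans (sumF-cong (λ j → [y-z]x≈yx-zx (X j t) (u j) (w j)))
                               (sumF-distrib-- (λ j → u j * X j t) (λ j → w j * X j t))

    lincomb--ʳ : ∀ (b : Coeffs k) (X Y : Vector (Coeffs n) k) t →
                 lincomb b (λ j t → X j t - Y j t) t ≡ lincomb b X t - lincomb b Y t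
    lincomb--ʳ b X Y t = trans (sumF-cong (λ j → x[y-z]≈xy-xz (b j) (X j t) (Y j t)))
                               (sumF-distrib-- (λ j → b j * X j t) (λ j → b j * Y j t))

module Echelon {q : ℕ} (F : FiniteField q) where

  open import Level using (0ℓ)
  import Data.Nat as ℕ
  open import Data.Nat.Properties using (+-suc)
  open import Data.Fin using (zero; _≟_)
  open import Data.Fin.Properties using (any?; all?)
  open import Data.Vec.Functional using (head; tail; _∷_)
  open import Data.Vec.Functional.Properties using (∷-cong)
  open import Data.Unit using (⊤; tt)
  open import Data.Product using (∃; _×_; _,_)
  open import Function using (_∘_; _⇔_; mk⇔; Equivalence)
  open import Relation.Nullary using (Dec; yes; no)
  open import Relation.Nullary.Decidable using (map′; _×-dec_; ¬?; decidable-stable)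
  open import Relation.Unary using (Pred; Decidable)
  open import Relation.Binary.PropositionalEquality
  open FieldAlgebra F

  anyCoeffs? : ∀ k {P : Pred (Coeffs k) 0ℓ} → (∀ {b c} → b ≗ c → P b → P c) → Decidable P → Dec (∃ P)
  anyCoeffs? zero    resp P? = map′ (λ p → _ , p) (λ (b , pb) → resp (λ ()) pb) (P? (λ ()))
  anyCoeffs? (suc k) resp P? =
    map′ (λ (a , b , p) → a ∷ b , p) (λ (b , pb) → head b , tail b , resp (∷-cong refl λ _ → refl) pb)
         (any? λ a → anyCoeffs? k (resp ∘ ∷-cong refl) (λ b → P? (a ∷ b)))

  record Subspace (k : ℕ) : Set₁ where
    field
      Member      : Pred (Coeffs k) 0ℓ
      member?     : Decidable Member
      member-resp : ∀ {b c} → b ≗ c → Member b → Member c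
      0∈          : Member (λ _ → 0#)
      +-closed    : ∀ {b c} → Member b → Member c → Member (λ j → b j + c j)
      *-closed    : ∀ a {b} → Member b → Member (λ j → a * b j)

  open Subspace

  rowSpace : ∀ {m k} → Matrix m k → Subspace k
  rowSpace {m} A = record
    { Member      = InRowSpace A
    ; member?     = λ b → anyCoeffs? m
                        (λ c≗c′ b≡cA j → trans (b≡cA j) (sumF-cong λ i → cong (_* A i j) (c≗c′ i)))
                        (λ c → all? λ j → b j ≟ sumF (λ i → c i * A i j))
    ; member-resp = λ b≗b′ (c , b≡cA) → c , λ j → trans (sym (b≗b′ j)) (b≡cA j)
    ; 0∈          = (λ _ → 0#) , λ j → sym (trans (sumF-distribˡ-* 0# (λ i → A i j)) (zeroˡ _))
    ; +-closed    = λ (c , b≡cA) (c′ , b′≡c′A) → (λ i → c i + c′ i) , λ j →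
                      trans (cong₂ _+_ (b≡cA j) (b′≡c′A j))
                            (sym (trans (sumF-cong λ i → distribʳ (A i j) (c i) (c′ i))
                                        (sumF-distrib-+ (λ i → c i * A i j) (λ i → c′ i * A i j))))
    ; *-closed    = λ a (c , b≡cA) → (λ i → a * c i) , λ j →
                      trans (cong (a *_) (b≡cA j))
                            (sym (trans (sumF-cong λ i → *-assoc a (c i) (A i j))
                                        (sumF-distribˡ-* a (λ i → c i * A i j))))
    }

  -- A subspace of F_q^k in reduced row echelon form, read from the first coordinate: under
  -- `pivot v E` the subspace contains (1, v), and b lies in it iff tail b − b₀ v lies in E; under
  -- `free E` every vector of the subspace has b₀ = 0. There are r pivots and s free coordinates.
  data Echelon : ℕ → ℕ → ℕ → Set where
    []    : Echelon 0 0 0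
    pivot : ∀ {k r s} → Coeffs k → Echelon k r s → Echelon (suc k) (suc r) s
    free  : ∀ {k r s} → Echelon k r s → Echelon (suc k) r (suc s)

  ⟦_⟧ : ∀ {k r s} → Echelon k r s → Pred (Coeffs k) 0ℓ
  ⟦ []        ⟧ b = ⊤
  ⟦ pivot v E ⟧ b = ⟦ E ⟧ (λ j → tail b j - head b * v j)
  ⟦ free E    ⟧ b = head b ≡ 0# × ⟦ E ⟧ (tail b)

  echelon-size : ∀ {k r s} → Echelon k r s → k ≡ r ℕ.+ s
  echelon-size []                = refl
  echelon-size (pivot v E)       = cong suc (echelon-size E)
  echelon-size {r = r} (free E)  = trans (cong suc (echelon-size E)) (sym (+-suc r _))

  record EchelonForm {k : ℕ} (V : Subspace k) : Set where
    field
      {rank corank} : ℕ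
      shape         : Echelon k rank corank
      describes     : ∀ b → Member V b ⇔ ⟦ shape ⟧ b

  open EchelonForm
  open Equivalence

  zeroHeadTails : ∀ {k} → Subspace (suc k) → Subspace k
  zeroHeadTails V = record
    { Member      = λ b → Member V (0# ∷ b)
    ; member?     = λ b → member? V (0# ∷ b)
    ; member-resp = λ b≗c → member-resp V (∷-cong refl b≗c)
    ; 0∈          = member-resp V (∷-cong refl λ _ → refl) (0∈ V)
    ; +-closed    = λ b∈ c∈ → member-resp V (∷-cong (+-identityˡ 0#) λ _ → refl) (+-closed V b∈ c∈)
    ; *-closed    = λ a b∈ → member-resp V (∷-cong (zeroʳ a) λ _ → refl) (*-closed V a b∈)
    }

  normalise : ∀ {k} (V : Subspace (suc k)) {a} → Member V a → head a ≢ 0# →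
              ∃ λ a′ → Member V a′ × head a′ ≡ 1#
  normalise V {a} a∈V a₀≢0 =
    let y , a₀y≡1 = inverse (head a) a₀≢0 in
    (λ j → y * a j) , *-closed V y a∈V , trans (*-comm y (head a)) a₀y≡1

  pivotForm : ∀ {k} (V : Subspace (suc k)) {a} → Member V a → head a ≡ 1# →
              EchelonForm (zeroHeadTails V) → EchelonForm V
  pivotForm V {a} a∈V a₀≡1 E′ =
    record { shape = pivot (tail a) (shape E′) ; describes = λ b → mk⇔ (member⇒⟦⟧ b) (⟦⟧⇒member b) }
    where
    member⇒⟦⟧ : ∀ b → Member V b → ⟦ pivot (tail a) (shape E′) ⟧ b
    member⇒⟦⟧ b b∈V = describes E′ _ .to (member-resp V b-b₀a≗0∷
                                                       (+-closed V b∈V (*-closed V (- head b) a∈V)))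
      where
      b-b₀a≗0∷ : (λ j → b j + - head b * a j) ≗ 0# ∷ (λ j → tail b j - head b * tail a j)
      b-b₀a≗0∷ = ∷-cong (trans (cong (λ x → head b + - head b * x) a₀≡1)
                               (trans (cong (head b +_) (*-identityʳ _)) (x≈y⇒x∙y⁻¹≈ε refl)))
                        (λ j → cong (tail b j +_) (sym (-‿distribˡ-* (head b) (tail a j))))
    ⟦⟧⇒member : ∀ b → ⟦ pivot (tail a) (shape E′) ⟧ b → Member V b
    ⟦⟧⇒member b b′∈E =
      member-resp V 0∷+b₀a≗b (+-closed V (describes E′ _ .from b′∈E) (*-closed V (head b) a∈V))
      where
      0∷+b₀a≗b : (λ j → (0# ∷ (λ j → tail b j - head b * tail a j)) j + head b * a j) ≗ b
      0∷+b₀a≗b = ∷-cong (trans (+-identityˡ _) (trans (cong (head b *_) a₀≡1) (*-identityʳ _)))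
                        (λ j → //-rightDividesˡ (head b * tail a j) (tail b j))

  freeForm : ∀ {k} (V : Subspace (suc k)) → (∀ {b} → Member V b → head b ≡ 0#) →
             EchelonForm (zeroHeadTails V) → EchelonForm V
  freeForm V head≡0 E′ =
    record { shape = free (shape E′) ; describes = λ b → mk⇔ (member⇒⟦⟧ b) (⟦⟧⇒member b) }
    where
    member⇒⟦⟧ : ∀ b → Member V b → ⟦ free (shape E′) ⟧ b
    member⇒⟦⟧ b b∈V =
      head≡0 b∈V , describes E′ _ .to (member-resp V (∷-cong (head≡0 b∈V) λ _ → refl) b∈V)
    ⟦⟧⇒member : ∀ b → ⟦ free (shape E′) ⟧ b → Member V b
    ⟦⟧⇒member b (b₀≡0 , b′∈E) =
      member-resp V (∷-cong (sym b₀≡0) λ _ → refl) (describes E′ _ .from b′∈E)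

  echelonForm : ∀ {k} (V : Subspace k) → EchelonForm V
  echelonForm {zero} V =
    record { shape = [] ; describes = λ b → mk⇔ (λ _ → tt) (λ _ → member-resp V (λ ()) (0∈ V)) }
  echelonForm {suc k} V with anyCoeffs? (suc k) {λ b → Member V b × head b ≢ 0#}
                              (λ b≗c (b∈V , b₀≢0) → member-resp V b≗c b∈V , b₀≢0 ∘ trans (b≗c zero))
                              (λ b → member? V b ×-dec ¬? (head b ≟ 0#))
  ... | yes (a , a∈V , a₀≢0) = let a′ , a′∈V , a′₀≡1 = normalise V a∈V a₀≢0 in
                               pivotForm V a′∈V a′₀≡1 (echelonForm (zeroHeadTails V))
  ... | no ∄ = freeForm V (λ {b} b∈V → decidable-stable (head b ≟ 0#) (λ b₀≢0 → ∄ (b , b∈V , b₀≢0)))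
                        (echelonForm (zeroHeadTails V))

module Kernel {q : ℕ} (F : FiniteField q) (n : ℕ) where

  open import Data.Fin using (_≟_)
  open import Data.Fin.Properties using (all?)
  open import Data.Vec.Functional using (Vector; head; tail)
  open import Data.Unit using (⊤; tt)
  open import Data.Product using (∃; _×_; _,_; proj₁; proj₂)
  open import Function using (_⇔_; mk⇔; Equivalence)
  open import Relation.Nullary using (Dec; yes; no; ¬_; ¬?; contradiction)
  open import Relation.Nullary.Decidable using (_×-dec_)
  open import Relation.Unary using (Decidable)
  open import Relation.Binary.PropositionalEquality
  open FieldAlgebra F
  open Echelon F

  Points : ℕ → Set
  Points = Vector (Coeffs n)

  Annihilates : ∀ {k} → Coeffs k → Points k → Set
  Annihilates b D = ∀ t → lincomb b D t ≡ 0#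

  InSpan : ∀ {k} → Coeffs n → Points k → Set
  InSpan p D = ∃ λ w → ∀ t → p t ≡ lincomb w D t

  inSpan? : ∀ {k} (p : Coeffs n) (D : Points k) → Dec (InSpan p D)
  inSpan? {k} p D = anyCoeffs? k (λ w≗w′ p≡wD t → trans (p≡wD t) (lincomb-congˡ D w≗w′ t))
                                  (λ w → all? λ t → p t ≟ lincomb w D t)

  SatisfiesPivots : ∀ {k r s} → Echelon k r s → Points k → Set
  SatisfiesPivots []          D = ⊤
  SatisfiesPivots (pivot v E) D = (∀ t → head D t + lincomb v (tail D) t ≡ 0#) × SatisfiesPivots E (tail D)
  SatisfiesPivots (free E)    D = SatisfiesPivots E (tail D)

  FreeIndependent : ∀ {k r s} → Echelon k r s → Points k → Set
  FreeIndependent []          D = ⊤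
  FreeIndependent (pivot v E) D = FreeIndependent E (tail D)
  FreeIndependent (free E)    D = FreeIndependent E (tail D) × ¬ InSpan (head D) (tail D)

  freeIndependent? : ∀ {k r s} (E : Echelon k r s) → Decidable (FreeIndependent E)
  freeIndependent? []          D = yes tt
  freeIndependent? (pivot v E) D = freeIndependent? E (tail D)
  freeIndependent? (free E)    D = freeIndependent? E (tail D) ×-dec ¬? (inSpan? (head D) (tail D))

  lincomb-pivot : ∀ {k} (b : Coeffs (suc k)) (v : Coeffs k) (D : Points (suc k)) t →
                  head D t + lincomb v (tail D) t ≡ 0# →
                  lincomb b D t ≡ lincomb (λ j → tail b j - head b * v j) (tail D) t
  lincomb-pivot b v D t D₀+vD′≡0 = begin
    head b * head D t + bD′  ≡⟨ cong (λ x → head b * x + bD′) (+-inverseˡ-unique _ _ D₀+vD′≡0) ⟩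
    head b * - vD′ + bD′     ≡⟨ +-comm _ bD′ ⟩
    bD′ + head b * - vD′     ≡⟨ cong (bD′ +_) (sym (-‿distribʳ-* (head b) vD′)) ⟩
    bD′ - head b * vD′       ≡⟨ cong (λ x → bD′ - x) (sym (lincomb-*ˡ (head b) v (tail D) t)) ⟩
    bD′ - lincomb (λ j → head b * v j) (tail D) t
                             ≡⟨ sym (lincomb--ˡ (tail b) (λ j → head b * v j) (tail D) t) ⟩
    lincomb (λ j → tail b j - head b * v j) (tail D) t ∎
    where
    open ≡-Reasoning
    bD′ = lincomb (tail b) (tail D) t
    vD′ = lincomb v (tail D) t

  head≢0⇒InSpan : ∀ {k} (b : Coeffs (suc k)) (D : Points (suc k)) → head b ≢ 0# → Annihilates b D →
                  InSpan (head D) (tail D)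
  head≢0⇒InSpan b D b₀≢0 bD≡0 = (λ j → - y * tail b j) , λ t → begin
    head D t                                  ≡⟨ sym (*-identityˡ _) ⟩
    1# * head D t                             ≡⟨ cong (_* head D t) (sym (trans (*-comm y (head b)) b₀y≡1)) ⟩
    y * head b * head D t                     ≡⟨ *-assoc y (head b) (head D t) ⟩
    y * (head b * head D t)                   ≡⟨ cong (y *_) (+-inverseˡ-unique _ _ (bD≡0 t)) ⟩
    y * - lincomb (tail b) (tail D) t         ≡⟨ sym (-‿distribʳ-* y _) ⟩
    - (y * lincomb (tail b) (tail D) t)       ≡⟨ -‿distribˡ-* y _ ⟩
    - y * lincomb (tail b) (tail D) t         ≡⟨ sym (lincomb-*ˡ (- y) (tail b) (tail D) t) ⟩
    lincomb (λ j → - y * tail b j) (tail D) t ∎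
    where
    open ≡-Reasoning
    y = proj₁ (inverse (head b) b₀≢0)
    b₀y≡1 = proj₂ (inverse (head b) b₀≢0)

  annihilates⇔⟦⟧ : ∀ {k r s} (E : Echelon k r s) (D : Points k) → SatisfiesPivots E D → FreeIndependent E D →
                   ∀ b → Annihilates b D ⇔ ⟦ E ⟧ b
  annihilates⇔⟦⟧ []          D _ _ b = mk⇔ (λ _ → tt) (λ _ t → refl)
  annihilates⇔⟦⟧ (pivot v E) D (D₀+vD′≡0 , sat) indep b =
    mk⇔ (λ bD≡0 → to (λ t → trans (sym (lincomb-pivot b v D t (D₀+vD′≡0 t))) (bD≡0 t)))
        (λ b∈E t → trans (lincomb-pivot b v D t (D₀+vD′≡0 t)) (from b∈E t))
    where open Equivalence (annihilates⇔⟦⟧ E (tail D) sat indep (λ j → tail b j - head b * v j))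
  annihilates⇔⟦⟧ (free E) D sat (indep , D₀∉span) b = mk⇔ annihilates⇒⟦⟧ ⟦⟧⇒annihilates
    where
    open Equivalence (annihilates⇔⟦⟧ E (tail D) sat indep (tail b))
    drop-head : head b ≡ 0# → ∀ t → lincomb b D t ≡ lincomb (tail b) (tail D) t
    drop-head b₀≡0 t =
      trans (cong (λ x → x * head D t + bD′) b₀≡0) (trans (cong (_+ bD′) (zeroˡ _)) (+-identityˡ bD′))
      where bD′ = lincomb (tail b) (tail D) t
    annihilates⇒⟦⟧ : Annihilates b D → ⟦ free E ⟧ b
    annihilates⇒⟦⟧ bD≡0 with head b ≟ 0#
    ... | yes b₀≡0 = b₀≡0 , to (λ t → trans (sym (drop-head b₀≡0 t)) (bD≡0 t))
    ... | no  b₀≢0 = contradiction (head≢0⇒InSpan b D b₀≢0 bD≡0) D₀∉span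
    ⟦⟧⇒annihilates : ⟦ free E ⟧ b → Annihilates b D
    ⟦⟧⇒annihilates (b₀≡0 , b′∈E) t = trans (drop-head b₀≡0 t) (from b′∈E t)

module Fibres {q : ℕ} (F : FiniteField q) (n : ℕ) where

  open import Level using (0ℓ)
  open import Data.Fin using (Fin; _≟_)
  open import Data.Vec using (Vec; lookup; tabulate)
  open import Data.Vec.Properties using (≡-dec; lookup∘tabulate; tabulate∘lookup; tabulate-cong)
  open import Data.Vec.Functional using (Vector; head; tail; _∷_)
  open import Data.Unit using (⊤; tt)
  open import Data.Product using (∃; _×_; _,_)
  open import Function using (_⇔_; mk⇔)
  open import Relation.Nullary using (yes)
  open import Relation.Nullary.Decidable using (_×-dec_)
  open import Relation.Unary using (Pred; Decidable)
  open import Relation.Binary.PropositionalEquality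
  open FieldAlgebra F
  open Echelon F
  open Kernel F n

  Point : Set
  Point = Vec (Fin q) n

  Tuple : ℕ → Set
  Tuple = Vector Point

  columns : ∀ {k} → Tuple k → Points k
  columns x j = lookup (x j)

  _⊖ₚ_ : Point → Point → Coeffs n
  (p ⊖ₚ s) t = lookup p t - lookup s t

  _⊖_ : ∀ {k} → Tuple k → Tuple k → Points k
  (x ⊖ y) j = x j ⊖ₚ y j

  sameCombination⇔annihilates : ∀ {k} (b : Coeffs k) (x y : Tuple k) →
                                (∀ t → lincomb b (columns x) t ≡ lincomb b (columns y) t) ⇔ Annihilates b (x ⊖ y)
  sameCombination⇔annihilates b x y = mk⇔
    (λ bx≡by t → trans (lincomb--ʳ b (columns x) (columns y) t) (x≈y⇒x∙y⁻¹≈ε (bx≡by t)))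
    (λ b[x-y]≡0 t → x∙y⁻¹≈ε⇒x≈y _ _ (trans (sym (lincomb--ʳ b (columns x) (columns y) t)) (b[x-y]≡0 t)))

  pivotValue : ∀ {k} → Coeffs k → Tuple (suc k) → Point
  pivotValue v x = tabulate (λ t → lookup (head x) t + lincomb v (columns (tail x)) t)

  lookup-pivotValue : ∀ {k} (v : Coeffs k) x t →
                      lookup (pivotValue v x) t ≡ lookup (head x) t + lincomb v (columns (tail x)) t
  lookup-pivotValue v x = lookup∘tabulate _

  -- x lies over β when Σ_j a_j x_j = β_i for the i-th pivot row a = (0, …, 0, 1, v) of E, that is,
  -- β is the image of x under the linear map defined by the pivot rows.
  InFibre : ∀ {k r s} → Echelon k r s → Tuple r → Pred (Tuple k) 0ℓ
  InFibre []          β x = ⊤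
  InFibre (pivot v E) β x = pivotValue v x ≡ head β × InFibre E (tail β) (tail x)
  InFibre (free E)    β x = InFibre E β (tail x)

  inFibre? : ∀ {k r s} (E : Echelon k r s) β → Decidable (InFibre E β)
  inFibre? []          β x = yes tt
  inFibre? (pivot v E) β x = ≡-dec _≟_ (pivotValue v x) (head β) ×-dec inFibre? E (tail β) (tail x)
  inFibre? (free E)    β x = inFibre? E β (tail x)

  sameFibre⇒satisfiesPivots : ∀ {k r s} (E : Echelon k r s) {β x y} → InFibre E β x → InFibre E β y →
                              SatisfiesPivots E (x ⊖ y)
  sameFibre⇒satisfiesPivots []          _ _ = tt
  sameFibre⇒satisfiesPivots (free E)    x∈β y∈β = sameFibre⇒satisfiesPivots E x∈β y∈β
  sameFibre⇒satisfiesPivots (pivot v E) {x = x} {y} (xᵥ≡β₀ , x′∈β′) (yᵥ≡β₀ , y′∈β′) =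
    pivotRelation , sameFibre⇒satisfiesPivots E x′∈β′ y′∈β′
    where
    open ≡-Reasoning
    xᵥ = λ t → lookup (head x) t + lincomb v (columns (tail x)) t
    yᵥ = λ t → lookup (head y) t + lincomb v (columns (tail y)) t
    pivotRelation : ∀ t → head (x ⊖ y) t + lincomb v (tail (x ⊖ y)) t ≡ 0#
    pivotRelation t = begin
      head (x ⊖ y) t + lincomb v (tail (x ⊖ y)) t
        ≡⟨ cong (head (x ⊖ y) t +_) (lincomb--ʳ v (columns (tail x)) (columns (tail y)) t) ⟩
      head (x ⊖ y) t + (lincomb v (columns (tail x)) t - lincomb v (columns (tail y)) t)
        ≡⟨ sub-+-sub _ _ _ _ ⟩
      xᵥ t - yᵥ t
        ≡⟨ x≈y⇒x∙y⁻¹≈ε (trans (sym (lookup-pivotValue v x t))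
                       (trans (cong (λ p → lookup p t) (trans xᵥ≡β₀ (sym yᵥ≡β₀)))
                              (lookup-pivotValue v y t))) ⟩
      0# ∎

  solvePivot : ∀ {k} → Coeffs k → Point → Tuple k → Point
  solvePivot v p y = tabulate (λ t → lookup p t - lincomb v (columns y) t)

  pivotValue≡⇒head≡ : ∀ {k} (v : Coeffs k) (s : Point) (y : Tuple k) {p} → pivotValue v (s ∷ y) ≡ p →
                      s ≡ solvePivot v p y
  pivotValue≡⇒head≡ v s y pv≡p = trans (sym (tabulate∘lookup s)) (tabulate-cong λ t →
    +≡⇒≡- (trans (sym (lookup-pivotValue v (s ∷ y) t)) (cong (λ p → lookup p t) pv≡p)))

  subtractCombination : ∀ {k} → Point → Points k → Vec (Fin q) k → Point
  subtractCombination p D w = tabulate (λ t → lookup p t - lincomb (lookup w) D t)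

  InSpan-translate⇒≡ : ∀ {k} (p s : Point) (D : Points k) → InSpan (p ⊖ₚ s) D →
                       ∃ λ (w : Vec (Fin q) k) → s ≡ subtractCombination p D w
  InSpan-translate⇒≡ p s D (w , p-s≡wD) = tabulate w , trans (sym (tabulate∘lookup s)) (tabulate-cong λ t →
    trans (-≡⇒≡- (p-s≡wD t))
          (cong (λ z → lookup p t - z) (lincomb-congˡ D (λ j → sym (lookup∘tabulate w j)) t)))

module Counting {q : ℕ} (F : FiniteField q) {n : ℕ} (S : List (Fibres.Point F n)) (uS : Unique S) where

  open import Level using (0ℓ)
  open import Data.Nat using (_+_; _*_; _^_; _≤_; _<_; z≤n; s≤s; NonZero; >-nonZero; >-nonZero⁻¹)
  open import Data.Nat.Properties hiding (_≟_)
  open import Algebra.Properties.CommutativeSemigroup *-commutativeSemigroup using (x∙yz≈y∙xz)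
  open import Data.Fin using (Fin; zero; suc; _≟_)
  open import Data.Vec using (Vec; replicate)
  import Data.Vec.Properties as Vec
  open import Data.Vec.Functional using (head; tail; _∷_)
  open import Data.List as List using (length; allFin; cartesianProductWith)
  open import Data.List.Properties using (length-tabulate)
  open import Data.List.Membership.Propositional using (_∈_)
  open import Data.List.Membership.Propositional.Properties using (∈-allFin; ∈-cartesianProductWith⁻)
  open import Data.Product using (∃; ∃₂; _×_; _,_; proj₁; proj₂)
  open import Function using (id)
  open import Relation.Nullary using (contradiction)
  open import Relation.Unary using (Pred; Decidable; ∁; _∩_)
  open import Relation.Unary.Properties using (U?; ∁?; _∩?_)
  open import Relation.Binary.PropositionalEquality
  open FieldAlgebra F using (Coeffs; 0#; 0≢1)
  open Echelon F using (Echelon; []; pivot; free; echelon-size)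
  open Kernel F n using (Points; FreeIndependent; inSpan?; freeIndependent?)
  open Fibres F n
  open Sums
  open Enumeration

  Q : ℕ
  Q = q ^ n

  2≤q : 2 ≤ q
  2≤q = distinct⇒2≤ 0≢1
    where
    distinct⇒2≤ : ∀ {m} {a b : Fin m} → a ≢ b → 2 ≤ m
    distinct⇒2≤ {suc zero}    {zero} {zero} a≢b = contradiction refl a≢b
    distinct⇒2≤ {suc (suc m)}                 _   = s≤s (s≤s z≤n)

  instance
    nonZero-q : NonZero q
    nonZero-q = >-nonZero (≤-trans (s≤s z≤n) 2≤q)

    nonZero-Q : NonZero Q
    nonZero-Q = m^n≢0 q n

  allVecs : ∀ m → List (Vec (Fin q) m)
  allVecs = vecsOver (allFin q)

  ∈-allVecs : ∀ {m} (v : Vec (Fin q) m) → v ∈ allVecs m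
  ∈-allVecs = ∈-vecsOver ∈-allFin

  length-allVecs : ∀ m → length (allVecs m) ≡ q ^ m
  length-allVecs m = trans (length-vecsOver (allFin q) m) (cong (_^ m) (length-tabulate _))

  length-S≤Q : length S ≤ Q
  length-S≤Q = begin
    length S            ≡⟨ sym (*-identityʳ _) ⟩
    length S * 1        ≡⟨ sym (∑-const S 1) ⟩
    count U? S          ≤⟨ count≤length (Vec.≡-dec _≟_) U? uS (allVecs n) id
                                        (λ {s} _ → s , ∈-allVecs s , refl) ⟩
    length (allVecs n)  ≡⟨ length-allVecs n ⟩
    Q                   ∎
    where open ≤-Reasoning

  translatesInSpan≤ : ∀ {k} (p : Point) (D : Points k) → count (λ s → inSpan? (p ⊖ₚ s) D) S ≤ q ^ k
  translatesInSpan≤ {k} p D = ≤-trans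
    (count≤length (Vec.≡-dec _≟_) (λ s → inSpan? (p ⊖ₚ s) D) uS (allVecs k) (subtractCombination p D)
                  (λ {s} p-s∈span → let w , s≡ = InSpan-translate⇒≡ p s D p-s∈span in w , ∈-allVecs w , s≡))
    (≤-reflexive (length-allVecs k))

  tuples : ∀ k → List (Tuple k)
  tuples zero    = List.[ (λ ()) ]
  tuples (suc k) = cartesianProductWith _∷_ S (tuples k)

  ∈-tuples⁻ : ∀ {k x} → x ∈ tuples k → ∀ j → x j ∈ S
  ∈-tuples⁻ {suc k} x∈ j with ∈-cartesianProductWith⁻ _∷_ S (tuples k) x∈
  ∈-tuples⁻ {suc k} x∈ zero    | s , y , s∈S , y∈ , refl = s∈S
  ∈-tuples⁻ {suc k} x∈ (suc j) | s , y , s∈S , y∈ , refl = ∈-tuples⁻ y∈ j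

  ∑-tuples : ∀ {k} (f : Tuple (suc k) → ℕ) →
             ∑ (tuples (suc k)) f ≡ ∑[ s ∈ S ] ∑[ y ∈ tuples k ] f (s ∷ y)
  ∑-tuples {k} = ∑-cartesianProductWith _∷_ S (tuples k)

  count-headDetermined≤ : ∀ {k} {P : Pred (Tuple (suc k)) 0ℓ} {R : Pred (Tuple k) 0ℓ}
                          (P? : Decidable P) (R? : Decidable R) (g : Tuple k → Point) →
                          (∀ {s y} → P (s ∷ y) → s ≡ g y × R y) →
                          count P? (tuples (suc k)) ≤ count R? (tuples k)
  count-headDetermined≤ {k} P? R? g P⇒ = begin
    count P? (tuples (suc k))
      ≡⟨ ∑-tuples _ ⟩
    ∑[ s ∈ S ] ∑[ y ∈ tuples k ] 𝟙 (P? (s ∷ y))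
      ≡⟨ ∑-comm S (tuples k) _ ⟩
    ∑[ y ∈ tuples k ] count (λ s → P? (s ∷ y)) S
      ≤⟨ ∑-mono-≤ (tuples k) (λ y → count≤𝟙 (λ s → P? (s ∷ y)) uS (R? y) P⇒) ⟩
    count R? (tuples k) ∎
    where open ≤-Reasoning

  fibreSize : ∀ {k r s} → Echelon k r s → Tuple r → ℕ
  fibreSize E β = count (inFibre? E β) (tuples _)

  bad? : ∀ {k r s} (E : Echelon k r s) β x → Decidable (InFibre E β ∩ ∁ (λ y → FreeIndependent E (x ⊖ y)))
  bad? E β x = inFibre? E β ∩? ∁? (λ y → freeIndependent? E (x ⊖ y))

  badCount : ∀ {k r s} → Echelon k r s → Tuple r → Tuple k → ℕ
  badCount E β x = count (bad? E β x) (tuples _)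

  fibreSize-free : ∀ {k r s} (E : Echelon k r s) β → fibreSize (free E) β ≡ length S * fibreSize E β
  fibreSize-free E β = trans (∑-tuples _) (∑-const S (fibreSize E β))

  fibreSize≤ : ∀ {k r s} (E : Echelon k r s) β → fibreSize E β ≤ Q ^ s
  fibreSize≤ []          β = ≤-refl
  fibreSize≤ (pivot v E) β = ≤-trans
    (count-headDetermined≤ (inFibre? (pivot v E) β) (inFibre? E (tail β)) (solvePivot v (head β))
                           (λ {s} {y} (yᵥ≡β₀ , y∈β′) → pivotValue≡⇒head≡ v s y yᵥ≡β₀ , y∈β′))
    (fibreSize≤ E (tail β))
  fibreSize≤ {s = suc s} (free E) β = begin
    fibreSize (free E) β      ≡⟨ fibreSize-free E β ⟩
    length S * fibreSize E β  ≤⟨ *-mono-≤ length-S≤Q (fibreSize≤ E β) ⟩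
    Q * Q ^ s                 ∎
    where open ≤-Reasoning

  fibreSize-pivot≤∑ : ∀ {k r s} (v : Coeffs k) (E : Echelon k r s) β′ →
                      length S * fibreSize E β′ ≤ ∑[ β₀ ∈ allVecs n ] fibreSize (pivot v E) (β₀ ∷ β′)
  fibreSize-pivot≤∑ {k} v E β′ = begin
    length S * fibreSize E β′
      ≡⟨ sym (∑-const S _) ⟩
    ∑[ s ∈ S ] ∑[ y ∈ tuples k ] 𝟙 (inFibre? E β′ y)
      ≤⟨ ∑-mono-≤ S (λ s → ∑-mono-≤ (tuples k) (λ y →
           𝟙≤count (λ β₀ → inFibre? (pivot v E) (β₀ ∷ β′) (s ∷ y)) (inFibre? E β′ y)
                   (λ y∈β′ → pivotValue v (s ∷ y) , ∈-allVecs _ , refl , y∈β′))) ⟩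
    ∑[ s ∈ S ] ∑[ y ∈ tuples k ] ∑[ β₀ ∈ allVecs n ] 𝟙 (inFibre? (pivot v E) (β₀ ∷ β′) (s ∷ y))
      ≡⟨ ∑-cong S (λ s → ∑-comm (tuples k) (allVecs n) _) ⟩
    ∑[ s ∈ S ] ∑[ β₀ ∈ allVecs n ] ∑[ y ∈ tuples k ] 𝟙 (inFibre? (pivot v E) (β₀ ∷ β′) (s ∷ y))
      ≡⟨ ∑-comm S (allVecs n) _ ⟩
    ∑[ β₀ ∈ allVecs n ] ∑[ s ∈ S ] ∑[ y ∈ tuples k ] 𝟙 (inFibre? (pivot v E) (β₀ ∷ β′) (s ∷ y))
      ≡⟨ ∑-cong (allVecs n) (λ β₀ → sym (∑-tuples _)) ⟩
    ∑[ β₀ ∈ allVecs n ] fibreSize (pivot v E) (β₀ ∷ β′) ∎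
    where open ≤-Reasoning

  ∃-large-fibre : ∀ {k r s} (E : Echelon k r s) → ∃ λ β → length S ^ k ≤ Q ^ r * fibreSize E β
  ∃-large-fibre []                   = (λ ()) , ≤-refl
  ∃-large-fibre {suc k} {r} (free E) =
    let β , large = ∃-large-fibre E in β , (begin
      length S * length S ^ k             ≤⟨ *-monoʳ-≤ (length S) large ⟩
      length S * (Q ^ r * fibreSize E β)  ≡⟨ x∙yz≈y∙xz (length S) (Q ^ r) _ ⟩
      Q ^ r * (length S * fibreSize E β)  ≡⟨ cong (Q ^ r *_) (sym (fibreSize-free E β)) ⟩
      Q ^ r * fibreSize (free E) β        ∎)
    where open ≤-Reasoning
  ∃-large-fibre {suc k} {suc r} (pivot v E) =
    let β′ , large = ∃-large-fibre E
        N = λ β₀ → fibreSize (pivot v E) (β₀ ∷ β′)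
        β₀ , ∑N≤ = ∃-∑≤length*term (allVecs n) N (replicate n 0#)
    in β₀ ∷ β′ , (begin
      length S * length S ^ k              ≤⟨ *-monoʳ-≤ (length S) large ⟩
      length S * (Q ^ r * fibreSize E β′)  ≡⟨ x∙yz≈y∙xz (length S) (Q ^ r) _ ⟩
      Q ^ r * (length S * fibreSize E β′)  ≤⟨ *-monoʳ-≤ (Q ^ r) (≤-trans (fibreSize-pivot≤∑ v E β′) ∑N≤) ⟩
      Q ^ r * (length (allVecs n) * N β₀)  ≡⟨ cong (λ l → Q ^ r * (l * N β₀)) (length-allVecs n) ⟩
      Q ^ r * (Q * N β₀)                   ≡⟨ x∙yz≈y∙xz (Q ^ r) Q (N β₀) ⟩
      Q * (Q ^ r * N β₀)                   ≡⟨ sym (*-assoc Q (Q ^ r) (N β₀)) ⟩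
      Q * Q ^ r * N β₀                     ∎)
    where open ≤-Reasoning

  -- y = s ∷ y′ is bad for x iff y′ is bad for tail x, or head x − s lies in the span of the
  -- differences tail x ⊖ y′; the latter leaves at most q^k choices for s.
  badCount-free≤ : ∀ {k r s} (E : Echelon k r s) β x →
                   badCount (free E) β x ≤ length S * badCount E β (tail x) + q ^ k * fibreSize E β
  badCount-free≤ {k} E β x = begin
    badCount (free E) β x
      ≡⟨ ∑-tuples _ ⟩
    ∑[ s ∈ S ] ∑[ y ∈ tuples k ] 𝟙 (bad? (free E) β x (s ∷ y))
      ≤⟨ ∑-mono-≤ S (λ s → ∑-mono-≤ (tuples k) (λ y →
           𝟙-union-bound (inFibre? E β y) (freeIndependent? E (tail x ⊖ y)) (span? s y))) ⟩
    ∑[ s ∈ S ] ∑[ y ∈ tuples k ] (𝟙 (bad? E β (tail x) y) + 𝟙 (inFibre? E β y) * 𝟙 (span? s y))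
      ≡⟨ ∑-cong S (λ s → ∑-distrib-+ (tuples k) _ _) ⟩
    ∑[ s ∈ S ] (B′ + (∑[ y ∈ tuples k ] 𝟙 (inFibre? E β y) * 𝟙 (span? s y)))
      ≡⟨ ∑-distrib-+ S _ _ ⟩
    (∑[ s ∈ S ] B′) + (∑[ s ∈ S ] ∑[ y ∈ tuples k ] 𝟙 (inFibre? E β y) * 𝟙 (span? s y))
      ≡⟨ cong₂ _+_ (∑-const S _) (∑-comm S (tuples k) _) ⟩
    length S * B′ + (∑[ y ∈ tuples k ] ∑[ s ∈ S ] 𝟙 (inFibre? E β y) * 𝟙 (span? s y))
      ≡⟨ cong (length S * B′ +_)
              (∑-cong (tuples k) (λ y → ∑-distribˡ-* S (𝟙 (inFibre? E β y)) (λ s → 𝟙 (span? s y)))) ⟩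
    length S * B′ + (∑[ y ∈ tuples k ] 𝟙 (inFibre? E β y) * count (λ s → span? s y) S)
      ≤⟨ +-monoʳ-≤ (length S * B′) (∑-mono-≤ (tuples k) (λ y →
           *-monoʳ-≤ (𝟙 (inFibre? E β y)) (translatesInSpan≤ (head x) (tail x ⊖ y)))) ⟩
    length S * B′ + (∑[ y ∈ tuples k ] 𝟙 (inFibre? E β y) * q ^ k)
      ≡⟨ cong (length S * B′ +_)
              (trans (∑-cong (tuples k) (λ y → *-comm _ (q ^ k))) (∑-distribˡ-* (tuples k) (q ^ k) _)) ⟩
    length S * B′ + q ^ k * fibreSize E β ∎
    where
    open ≤-Reasoning
    B′ = badCount E β (tail x)
    span? = λ s y → inSpan? (head x ⊖ₚ s) (tail x ⊖ y)

  badCount< : ∀ {k r s} (E : Echelon k r s) β x → Q * badCount E β x < q ^ k * Q ^ s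
  badCount< []          β x = s≤s (≤-reflexive (*-zeroʳ Q))
  badCount< {suc k} {s = s} (pivot v E) β x = begin-strict
    Q * badCount (pivot v E) β x      ≤⟨ *-monoʳ-≤ Q headDetermined ⟩
    Q * badCount E (tail β) (tail x)  <⟨ badCount< E (tail β) (tail x) ⟩
    q ^ k * Q ^ s                     ≤⟨ *-monoˡ-≤ (Q ^ s) (m≤n*m (q ^ k) q) ⟩
    q * q ^ k * Q ^ s                 ∎
    where
    open ≤-Reasoning
    headDetermined =
      count-headDetermined≤ (bad? (pivot v E) β x) (bad? E (tail β) (tail x)) (solvePivot v (head β))
        (λ {s} {y} ((yᵥ≡β₀ , y∈β′) , dependent) → pivotValue≡⇒head≡ v s y yᵥ≡β₀ , y∈β′ , dependent)
  badCount< {suc k} {s = suc s} (free E) β x = begin-strict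
    Q * badCount (free E) β x
      ≤⟨ *-monoʳ-≤ Q (badCount-free≤ E β x) ⟩
    Q * (length S * B′ + q ^ k * fibreSize E β)
      ≡⟨ *-distribˡ-+ Q _ _ ⟩
    Q * (length S * B′) + Q * (q ^ k * fibreSize E β)
      <⟨ +-mono-<-≤ (≤-<-trans (*-monoʳ-≤ Q (*-monoˡ-≤ B′ length-S≤Q))
                               (*-monoʳ-< Q (badCount< E β (tail x))))
                    (*-monoʳ-≤ Q (*-monoʳ-≤ (q ^ k) (fibreSize≤ E β))) ⟩
    Q * T + Q * T               ≡⟨ cong (Q * T +_) (sym (+-identityʳ (Q * T))) ⟩
    2 * (Q * T)                 ≤⟨ *-monoˡ-≤ (Q * T) 2≤q ⟩
    q * (Q * T)                 ≡⟨ cong (q *_) (x∙yz≈y∙xz Q (q ^ k) (Q ^ s)) ⟩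
    q * (q ^ k * (Q * Q ^ s))   ≡⟨ sym (*-assoc q (q ^ k) _) ⟩
    q * q ^ k * (Q * Q ^ s)     ∎
    where
    open ≤-Reasoning
    B′ = badCount E β (tail x)
    T = q ^ k * Q ^ s

  ∃-good-pair : ∀ {k r s} (E : Echelon k r s) → q ^ k * Q ^ k ≤ Q * length S ^ k →
                ∃₂ λ x y → (∀ j → x j ∈ S) × (∀ j → y j ∈ S) ×
                           ∃ λ β → InFibre E β x × InFibre E β y × FreeIndependent E (x ⊖ y)
  ∃-good-pair {k} {r} {s} E bound =
    let x , x∈ , x∈β = count>0⇒∃ (inFibre? E β) (tuples k) 0<N
        y , y∈ , y∈β , independent = count-∩∁<count⇒∃ (inFibre? E β) (λ y → freeIndependent? E (x ⊖ y))
                                                        (tuples k) (badCount<fibreSize x)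
    in x , y , ∈-tuples⁻ x∈ , ∈-tuples⁻ y∈ , β , x∈β , y∈β , independent
    where
    open ≤-Reasoning
    β = proj₁ (∃-large-fibre E)
    N = fibreSize E β
    qQ≤QN : q ^ k * Q ^ s ≤ Q * N
    qQ≤QN = *-cancelˡ-≤ (Q ^ r) {{m^n≢0 Q r}} (begin
      Q ^ r * (q ^ k * Q ^ s)  ≡⟨ x∙yz≈y∙xz (Q ^ r) (q ^ k) (Q ^ s) ⟩
      q ^ k * (Q ^ r * Q ^ s)  ≡⟨ cong (q ^ k *_) (sym (^-distribˡ-+-* Q r s)) ⟩
      q ^ k * Q ^ (r + s)      ≡⟨ cong (λ e → q ^ k * Q ^ e) (sym (echelon-size E)) ⟩
      q ^ k * Q ^ k            ≤⟨ bound ⟩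
      Q * length S ^ k         ≤⟨ *-monoʳ-≤ Q (proj₂ (∃-large-fibre E)) ⟩
      Q * (Q ^ r * N)          ≡⟨ x∙yz≈y∙xz Q (Q ^ r) N ⟩
      Q ^ r * (Q * N)          ∎)
    0<N : 0 < N
    0<N = >-nonZero⁻¹ N {{m*n≢0⇒n≢0 Q {{>-nonZero (<-≤-trans 0<qQ qQ≤QN)}}}}
      where 0<qQ = >-nonZero⁻¹ (q ^ k * Q ^ s) {{m*n≢0 (q ^ k) (Q ^ s) {{m^n≢0 q k}} {{m^n≢0 Q s}}}}
    badCount<fibreSize : ∀ x → badCount E β x < N
    badCount<fibreSize x = *-cancelˡ-< Q _ _ (<-≤-trans (badCount< E β x) qQ≤QN)

open import Data.Nat using (_+_; _*_; _^_; _≤_; _∸_)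
open import Data.Nat.Properties using (≤-trans; *-monoʳ-≤)
open import Data.Fin using (Fin)
open import Data.Vec using (Vec; lookup)
open import Data.List using (length)
open import Data.List.Membership.Propositional using (_∈_)
open import Data.Product using (∃₂; _×_; _,_)
open import Function.Bundles using (_⇔_)
open import Function.Properties.Equivalence using () renaming (trans to ⇔-trans; sym to ⇔-sym)
open import Relation.Binary.PropositionalEquality using (_≡_)

lemma4p1 : (q : ℕ) → IsPrimePower q → (F : FiniteField q) →
    let open FiniteField F using (Matrix) in
    (m k n : ℕ) → (A : Matrix m k) → FiniteField.NonZeroMatrix F A →
    (S : List (Vec (Fin q) n)) → Unique S →
    q ^ (k + (k ∸ 1) * n) ≤ length S ^ k →
    ∃₂ λ (x y : Fin k → Vec (Fin q) n) →
      (∀ j → x j ∈ S) × (∀ j → y j ∈ S) ×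
      (∀ (b : Fin k → Fin q) →
        ((∀ t → FiniteField.lincomb F b (λ j → lookup (x j)) t ≡ FiniteField.lincomb F b (λ j → lookup (y j)) t)
          ⇔ FiniteField.InRowSpace F A b))
lemma4p1 q _ F m k n A _ S uS bound =
  let x , y , x∈S , y∈S , β , x∈β , y∈β , independent =
        ∃-good-pair shape (≤-trans (power-bound q n k) (*-monoʳ-≤ Q bound))
      kernel = annihilates⇔⟦⟧ shape (x ⊖ y) (sameFibre⇒satisfiesPivots shape x∈β y∈β) independent
  in x , y , x∈S , y∈S , λ b →
       ⇔-trans (sameCombination⇔annihilates b x y) (⇔-trans (kernel b) (⇔-sym (describes b)))
  where
  open Echelon F using (echelonForm; rowSpace; module EchelonForm)
  open EchelonForm (echelonForm (rowSpace A))
  open Kernel F n using (annihilates⇔⟦⟧)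
  open Fibres F n using (_⊖_; sameFibre⇒satisfiesPivots; sameCombination⇔annihilates)
  open Counting F S uS using (Q; nonZero-q; ∃-good-pair)
  open Powers using (power-bound)
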